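{- Let $P$ be the infinite matrix indexed by the non-negative integers with entries $P(r+1,r)=1$, $P(r,r)=r-1$, $P(r,r+1)=-r-1$ for $r\geq 0$, and $P(r,s)=0$ for $|r-s|>1$. Then for every $n\geq 0$, \[B^{\pm}(n)=P^n(0,0).\]
   Context: $S(n,k)$ denotes the Stirling numbers of the second kind and $B^{\pm}(n)=\sum_{k=0}^n(-1)^kS(n,k)$. Powers of $P$ are well defined since every row and column of $P$ has only finitely many nonzero entries; $P^0=I$. -}

module Defs where

open import Data.Nat as ℕ using (ℕ; zero; suc; _≟_)
open import Data.Integer using (ℤ; +_; -_; _+_; _*_; _-_; -1ℤ; 0ℤ; 1ℤ)
open import Relation.Nullary using (yes; no)

S : ℕ → ℕ → ℕ
S zero    zero    = 1
S zero    (suc k) = 0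
S (suc n) zero    = 0
S (suc n) (suc k) = suc k ℕ.* S n (suc k) ℕ.+ S n k

sgn : ℕ → ℤ
sgn zero    = 1ℤ
sgn (suc k) = - sgn k

sumBelow : ℕ → (ℕ → ℤ) → ℤ
sumBelow zero    f = 0ℤ
sumBelow (suc m) f = sumBelow m f + f m

Bpm : ℕ → ℤ
Bpm n = sumBelow (suc n) (λ k → sgn k * (+ S n k))

P : ℕ → ℕ → ℤ
P r s with r ≟ suc s
... | yes _ = 1ℤ
... | no _ with r ≟ s
...   | yes _ = + r - 1ℤ
...   | no _ with suc r ≟ s
...     | yes _ = - (+ r) - 1ℤ
...     | no _ = 0ℤ

-- Matrix powers. Since P(r,k) = 0 for k > r+1, the (a priori infinite) sum
-- (P · M)(r,s) = Σ_k P(r,k) M(k,s) reduces to the finite sum over k ≤ r+1.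
-- P^0 = I, P^(n+1) = P · P^n.
Ppow : ℕ → ℕ → ℕ → ℤ
Ppow zero    r s with r ≟ s
... | yes _ = 1ℤ
... | no _  = 0ℤ
Ppow (suc n) r s = sumBelow (suc (suc r)) (λ k → P r k * Ppow n k s)

-- Put A(n,r) = Σ_k (-1)^k S(n,k) C(k,r), so that B^±(n) = A(n,0). The Stirling recurrence
-- S(n+1,k) = k S(n,k) + S(n,k-1), the absorption identity k C(k,r) = r C(k,r) + (r+1) C(k,r+1)
-- and Pascal's rule give A(n+1,r) = r A(n,r) + (r+1) A(n,r+1) - A(n,r-1) - A(n,r).
-- After the sign twist v(r) = (-1)^r A(n,r) this is the tridiagonal recurrence
-- (P v)(r) = v(r-1) + (r-1) v(r) - (r+1) v(r+1), so v is column 0 of P^n.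
module Submission where

open import Defs
open import Data.Nat using (ℕ)
open import Relation.Binary.PropositionalEquality using (_≡_)

open import Data.Empty using (⊥-elim)
open import Data.Integer using (ℤ; +_; -_; _+_; _*_; _-_; 0ℤ; 1ℤ)
import Data.Integer.Properties as ℤ
import Data.Integer.Tactic.RingSolver as ℤ-Ring
open import Data.Nat as ℕ using (zero; suc; _≟_; _<_; s≤s)
open import Data.Nat.Combinatorics using (_C_; nC1≡n; nCk+nC[k+1]≡[n+1]C[k+1])
import Data.Nat.Properties as ℕ
import Data.Nat.Tactic.RingSolver as ℕ-Ring
open import Function using (_∘_)
open import Relation.Binary.PropositionalEquality using (refl; sym; trans; cong; cong₂; module ≡-Reasoning)
open import Relation.Nullary using (yes; no)

open ≡-Reasoning

sumBelow-cong : ∀ m {f g : ℕ → ℤ} → (∀ k → f k ≡ g k) → sumBelow m f ≡ sumBelow m g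
sumBelow-cong zero    f≡g = refl
sumBelow-cong (suc m) f≡g = cong₂ _+_ (sumBelow-cong m f≡g) (f≡g m)

sumBelow-+ : ∀ m (f g : ℕ → ℤ) → sumBelow m (λ k → f k + g k) ≡ sumBelow m f + sumBelow m g
sumBelow-+ zero    f g = refl
sumBelow-+ (suc m) f g = begin
  sumBelow m (λ k → f k + g k) + (f m + g m)  ≡⟨ cong (_+ (f m + g m)) (sumBelow-+ m f g) ⟩
  sumBelow m f + sumBelow m g + (f m + g m)    ≡⟨ interchange (sumBelow m f) (sumBelow m g) (f m) (g m) ⟩
  sumBelow m f + f m + (sumBelow m g + g m)    ∎
  where
  interchange : ∀ a b c d → a + b + (c + d) ≡ a + c + (b + d)
  interchange = ℤ-Ring.solve-∀

sumBelow-*ˡ : ∀ m c (f : ℕ → ℤ) → sumBelow m (λ k → c * f k) ≡ c * sumBelow m f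
sumBelow-*ˡ zero    c f = sym (ℤ.*-zeroʳ c)
sumBelow-*ˡ (suc m) c f = begin
  sumBelow m (λ k → c * f k) + c * f m  ≡⟨ cong (_+ c * f m) (sumBelow-*ˡ m c f) ⟩
  c * sumBelow m f + c * f m            ≡⟨ ℤ.*-distribˡ-+ c (sumBelow m f) (f m) ⟨
  c * (sumBelow m f + f m)              ∎

sumBelow-neg : ∀ m (f : ℕ → ℤ) → sumBelow m (λ k → - f k) ≡ - sumBelow m f
sumBelow-neg zero    f = refl
sumBelow-neg (suc m) f = begin
  sumBelow m (λ k → - f k) + - f m  ≡⟨ cong (_+ - f m) (sumBelow-neg m f) ⟩
  - sumBelow m f + - f m            ≡⟨ ℤ.neg-distrib-+ (sumBelow m f) (f m) ⟨
  - (sumBelow m f + f m)            ∎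

sumBelow-vanishing : ∀ m (f : ℕ → ℤ) → (∀ k → k < m → f k ≡ 0ℤ) → sumBelow m f ≡ 0ℤ
sumBelow-vanishing zero    f f≡0 = refl
sumBelow-vanishing (suc m) f f≡0 =
  cong₂ _+_ (sumBelow-vanishing m f (λ k k<m → f≡0 k (ℕ.m<n⇒m<1+n k<m))) (f≡0 m (ℕ.n<1+n m))

sumBelow-sucˡ : ∀ m (f : ℕ → ℤ) → sumBelow (suc m) f ≡ f 0 + sumBelow m (f ∘ suc)
sumBelow-sucˡ zero    f = trans (ℤ.+-identityˡ (f 0)) (sym (ℤ.+-identityʳ (f 0)))
sumBelow-sucˡ (suc m) f = begin
  sumBelow (suc m) f + f (suc m)                  ≡⟨ cong (_+ f (suc m)) (sumBelow-sucˡ m f) ⟩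
  f 0 + sumBelow m (f ∘ suc) + f (suc m)          ≡⟨ ℤ.+-assoc (f 0) (sumBelow m (f ∘ suc)) (f (suc m)) ⟩
  f 0 + (sumBelow m (f ∘ suc) + f (suc m))        ∎

sumBelow-shift : ∀ m (f : ℕ → ℤ) → f 0 ≡ 0ℤ → f m ≡ 0ℤ → sumBelow m (f ∘ suc) ≡ sumBelow m f
sumBelow-shift m f f0≡0 fm≡0 = begin
  sumBelow m (f ∘ suc)        ≡⟨ ℤ.+-identityˡ _ ⟨
  0ℤ + sumBelow m (f ∘ suc)   ≡⟨ cong (_+ sumBelow m (f ∘ suc)) f0≡0 ⟨
  f 0 + sumBelow m (f ∘ suc)  ≡⟨ sumBelow-sucˡ m f ⟨
  sumBelow m f + f m          ≡⟨ cong (λ x → sumBelow m f + x) fm≡0 ⟩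
  sumBelow m f + 0ℤ           ≡⟨ ℤ.+-identityʳ _ ⟩
  sumBelow m f                ∎

S-above-diagonal : ∀ {n k} → n < k → S n k ≡ 0
S-above-diagonal {zero}  {suc k} _          = refl
S-above-diagonal {suc n} {suc k} (s≤s n<k)
  rewrite S-above-diagonal (ℕ.m<n⇒m<1+n n<k) | S-above-diagonal n<k
  = trans (ℕ.+-identityʳ (suc k ℕ.* 0)) (ℕ.*-zeroʳ (suc k))

n*nCr≡r*nCr+[r+1]*nC[r+1] : ∀ n r → n ℕ.* (n C r) ≡ r ℕ.* (n C r) ℕ.+ suc r ℕ.* (n C suc r)
n*nCr≡r*nCr+[r+1]*nC[r+1] zero    zero    = refl
n*nCr≡r*nCr+[r+1]*nC[r+1] zero    (suc r) =
  sym (cong₂ ℕ._+_ (ℕ.*-zeroʳ (suc r)) (ℕ.*-zeroʳ (suc (suc r))))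
n*nCr≡r*nCr+[r+1]*nC[r+1] (suc n) zero    = begin
  suc n ℕ.* 1  ≡⟨ ℕ.*-identityʳ (suc n) ⟩
  suc n        ≡⟨ nC1≡n (suc n) ⟨
  suc n C 1    ≡⟨ ℕ.+-identityʳ (suc n C 1) ⟨
  1 ℕ.* (suc n C 1)  ∎
n*nCr≡r*nCr+[r+1]*nC[r+1] (suc n) (suc r) = begin
  suc n ℕ.* (suc n C suc r)
    ≡⟨ cong (suc n ℕ.*_) (pascal r) ⟨
  suc n ℕ.* (a ℕ.+ b)
    ≡⟨ expand n a b ⟩
  n ℕ.* a ℕ.+ a ℕ.+ (n ℕ.* b ℕ.+ b)
    ≡⟨ cong₂ (λ x y → x ℕ.+ a ℕ.+ (y ℕ.+ b))
             (n*nCr≡r*nCr+[r+1]*nC[r+1] n r) (n*nCr≡r*nCr+[r+1]*nC[r+1] n (suc r)) ⟩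
  r ℕ.* a ℕ.+ suc r ℕ.* b ℕ.+ a ℕ.+ (suc r ℕ.* b ℕ.+ suc (suc r) ℕ.* c ℕ.+ b)
    ≡⟨ regroup r a b c ⟩
  suc r ℕ.* (a ℕ.+ b) ℕ.+ suc (suc r) ℕ.* (b ℕ.+ c)
    ≡⟨ cong₂ (λ x y → suc r ℕ.* x ℕ.+ suc (suc r) ℕ.* y) (pascal r) (pascal (suc r)) ⟩
  suc r ℕ.* (suc n C suc r) ℕ.+ suc (suc r) ℕ.* (suc n C suc (suc r))  ∎
  where
  a b c : ℕ
  a = n C r
  b = n C suc r
  c = n C suc (suc r)
  pascal : ∀ k → n C k ℕ.+ n C suc k ≡ suc n C suc k
  pascal = nCk+nC[k+1]≡[n+1]C[k+1] n
  expand : ∀ n a b → suc n ℕ.* (a ℕ.+ b) ≡ n ℕ.* a ℕ.+ a ℕ.+ (n ℕ.* b ℕ.+ b)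
  expand = ℕ-Ring.solve-∀
  regroup : ∀ r a b c → r ℕ.* a ℕ.+ suc r ℕ.* b ℕ.+ a ℕ.+ (suc r ℕ.* b ℕ.+ suc (suc r) ℕ.* c ℕ.+ b)
                      ≡ suc r ℕ.* (a ℕ.+ b) ℕ.+ suc (suc r) ℕ.* (b ℕ.+ c)
  regroup = ℕ-Ring.solve-∀

P-sub : ∀ r → P (suc r) r ≡ 1ℤ
P-sub r with suc r ≟ suc r
... | yes _ = refl
... | no r≢r = ⊥-elim (r≢r refl)

P-diag : ∀ r → P r r ≡ + r - 1ℤ
P-diag r with r ≟ suc r
... | yes r≡1+r = ⊥-elim (ℕ.1+n≢n (sym r≡1+r))
... | no _ with r ≟ r
...   | yes _ = refl
...   | no r≢r = ⊥-elim (r≢r refl)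

P-sup : ∀ r → P r (suc r) ≡ - (+ r) - 1ℤ
P-sup r with r ≟ suc (suc r)
... | yes r≡2+r = ⊥-elim (ℕ.m+1+n≢n 1 (sym r≡2+r))
... | no _ with r ≟ suc r
...   | yes r≡1+r = ⊥-elim (ℕ.1+n≢n (sym r≡1+r))
...   | no _ with suc r ≟ suc r
...     | yes _ = refl
...     | no r≢r = ⊥-elim (r≢r refl)

P-far : ∀ {r k} → suc k < r → P r k ≡ 0ℤ
P-far {r} {k} 1+k<r with r ≟ suc k
... | yes refl = ⊥-elim (ℕ.<-irrefl refl 1+k<r)
... | no _ with r ≟ k
...   | yes refl = ⊥-elim (ℕ.<⇒≱ 1+k<r (ℕ.n≤1+n r))
...   | no _ with suc r ≟ k
...     | yes refl = ⊥-elim (ℕ.<⇒≱ 1+k<r (ℕ.m≤n+m r 2))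
...     | no _ = refl

P-row-zero : ∀ (g : ℕ → ℤ) → sumBelow 2 (λ k → P 0 k * g k) ≡ - g 0 - g 1
P-row-zero g = simplify (g 0) (g 1)
  where
  simplify : ∀ a b → 0ℤ + - 1ℤ * a + - 1ℤ * b ≡ - a - b
  simplify = ℤ-Ring.solve-∀

P-row-suc : ∀ (g : ℕ → ℤ) r →
  sumBelow (3 ℕ.+ r) (λ k → P (suc r) k * g k) ≡ g r + + r * g (suc r) - + (2 ℕ.+ r) * g (2 ℕ.+ r)
P-row-suc g r
  rewrite sumBelow-vanishing r (λ k → P (suc r) k * g k)
            (λ k k<r → trans (cong (_* g k) (P-far (s≤s k<r))) (ℤ.*-zeroˡ (g k)))
        | P-sub r | P-diag (suc r) | P-sup (suc r)
  = simplify (+ r) (g r) (g (suc r)) (g (2 ℕ.+ r))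
  where
  simplify : ∀ x a b c → 0ℤ + 1ℤ * a + ((1ℤ + x) - 1ℤ) * b + (- (1ℤ + x) - 1ℤ) * c
                       ≡ a + x * b - (1ℤ + (1ℤ + x)) * c
  simplify = ℤ-Ring.solve-∀

altStirling : ℕ → (ℕ → ℤ) → ℤ
altStirling n w = sumBelow (suc n) (λ k → sgn k * + S n k * w k)

altStirling-cong : ∀ n {v w : ℕ → ℤ} → (∀ k → v k ≡ w k) → altStirling n v ≡ altStirling n w
altStirling-cong n v≡w = sumBelow-cong (suc n) (λ k → cong (sgn k * + S n k *_) (v≡w k))

altStirling-+ : ∀ n (v w : ℕ → ℤ) → altStirling n (λ k → v k + w k) ≡ altStirling n v + altStirling n w
altStirling-+ n v w = trans
  (sumBelow-cong (suc n) (λ k → ℤ.*-distribˡ-+ (sgn k * + S n k) (v k) (w k)))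
  (sumBelow-+ (suc n) _ _)

altStirling-*ˡ : ∀ n c (w : ℕ → ℤ) → altStirling n (λ k → c * w k) ≡ c * altStirling n w
altStirling-*ˡ n c w = trans
  (sumBelow-cong (suc n) (λ k → commute (sgn k * + S n k) c (w k)))
  (sumBelow-*ˡ (suc n) c _)
  where
  commute : ∀ a c x → a * (c * x) ≡ c * (a * x)
  commute = ℤ-Ring.solve-∀

altStirling-suc : ∀ n (w : ℕ → ℤ) →
  altStirling (suc n) w ≡ altStirling n (λ k → + k * w k) - altStirling n (w ∘ suc)
altStirling-suc n w = begin
  sumBelow (2 ℕ.+ n) term
    ≡⟨ sumBelow-sucˡ (suc n) term ⟩
  term 0 + sumBelow (suc n) (term ∘ suc)
    ≡⟨ cong (_+ sumBelow (suc n) (term ∘ suc)) (ℤ.*-zeroˡ (w 0)) ⟩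
  0ℤ + sumBelow (suc n) (term ∘ suc)
    ≡⟨ ℤ.+-identityˡ _ ⟩
  sumBelow (suc n) (term ∘ suc)
    ≡⟨ sumBelow-cong (suc n) term-suc ⟩
  sumBelow (suc n) (λ k → weighted (suc k) + - shifted k)
    ≡⟨ sumBelow-+ (suc n) (weighted ∘ suc) (λ k → - shifted k) ⟩
  sumBelow (suc n) (weighted ∘ suc) + sumBelow (suc n) (λ k → - shifted k)
    ≡⟨ cong₂ _+_ (sumBelow-shift (suc n) weighted weighted-first weighted-last)
                 (sumBelow-neg (suc n) shifted) ⟩
  altStirling n (λ k → + k * w k) - altStirling n (w ∘ suc)  ∎
  where
  term weighted shifted : ℕ → ℤ
  term     k = sgn k * + S (suc n) k * w k
  weighted k = sgn k * + S n k * (+ k * w k)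
  shifted  k = sgn k * + S n k * w (suc k)

  weighted-first : weighted 0 ≡ 0ℤ
  weighted-first = trans (cong (sgn 0 * + S n 0 *_) (ℤ.*-zeroˡ (w 0))) (ℤ.*-zeroʳ (sgn 0 * + S n 0))

  weighted-last : weighted (suc n) ≡ 0ℤ
  weighted-last = begin
    sgn (suc n) * + S n (suc n) * (+ suc n * w (suc n))
      ≡⟨ cong (λ m → sgn (suc n) * + m * (+ suc n * w (suc n))) (S-above-diagonal (ℕ.n<1+n n)) ⟩
    sgn (suc n) * 0ℤ * (+ suc n * w (suc n))
      ≡⟨ cong (_* (+ suc n * w (suc n))) (ℤ.*-zeroʳ (sgn (suc n))) ⟩
    0ℤ * (+ suc n * w (suc n))
      ≡⟨ ℤ.*-zeroˡ (+ suc n * w (suc n)) ⟩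
    0ℤ  ∎

  expand : ∀ s k a b x → - s * (k * a + b) * x ≡ - s * a * (k * x) + - (s * b * x)
  expand = ℤ-Ring.solve-∀

  term-suc : ∀ k → term (suc k) ≡ weighted (suc k) + - shifted k
  term-suc k = begin
    - sgn k * + (suc k ℕ.* S n (suc k) ℕ.+ S n k) * w (suc k)
      ≡⟨ cong (λ x → - sgn k * x * w (suc k))
              (trans (ℤ.pos-+ (suc k ℕ.* S n (suc k)) (S n k))
                     (cong (_+ + S n k) (ℤ.pos-* (suc k) (S n (suc k))))) ⟩
    - sgn k * (+ suc k * + S n (suc k) + + S n k) * w (suc k)
      ≡⟨ expand (sgn k) (+ suc k) (+ S n (suc k)) (+ S n k) (w (suc k)) ⟩
    weighted (suc k) + - shifted k  ∎

altStirlingBinomial : ℕ → ℕ → ℤ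
altStirlingBinomial n r = altStirling n (λ k → + (k C r))

altStirlingBinomial-suc : ∀ n r →
  altStirlingBinomial (suc n) r
    ≡ + r * altStirlingBinomial n r + + suc r * altStirlingBinomial n (suc r)
      - altStirling n (λ k → + (suc k C r))
altStirlingBinomial-suc n r = begin
  altStirlingBinomial (suc n) r
    ≡⟨ altStirling-suc n (λ k → + (k C r)) ⟩
  altStirling n (λ k → + k * + (k C r)) - altStirling n (λ k → + (suc k C r))
    ≡⟨ cong (_- altStirling n (λ k → + (suc k C r))) absorbed ⟩
  + r * altStirlingBinomial n r + + suc r * altStirlingBinomial n (suc r)
    - altStirling n (λ k → + (suc k C r))  ∎
  where
  absorb : ∀ k → + k * + (k C r) ≡ + r * + (k C r) + + suc r * + (k C suc r)
  absorb k = begin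
    + k * + (k C r)                                      ≡⟨ ℤ.pos-* k (k C r) ⟨
    + (k ℕ.* (k C r))                                    ≡⟨ cong +_ (n*nCr≡r*nCr+[r+1]*nC[r+1] k r) ⟩
    + (r ℕ.* (k C r) ℕ.+ suc r ℕ.* (k C suc r))          ≡⟨ ℤ.pos-+ (r ℕ.* (k C r)) _ ⟩
    + (r ℕ.* (k C r)) + + (suc r ℕ.* (k C suc r))        ≡⟨ cong₂ _+_ (ℤ.pos-* r (k C r)) (ℤ.pos-* (suc r) _) ⟩
    + r * + (k C r) + + suc r * + (k C suc r)            ∎

  absorbed : altStirling n (λ k → + k * + (k C r))
           ≡ + r * altStirlingBinomial n r + + suc r * altStirlingBinomial n (suc r)
  absorbed = begin
    altStirling n (λ k → + k * + (k C r))
      ≡⟨ altStirling-cong n absorb ⟩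
    altStirling n (λ k → + r * + (k C r) + + suc r * + (k C suc r))
      ≡⟨ altStirling-+ n _ _ ⟩
    altStirling n (λ k → + r * + (k C r)) + altStirling n (λ k → + suc r * + (k C suc r))
      ≡⟨ cong₂ _+_ (altStirling-*ˡ n (+ r) _) (altStirling-*ˡ n (+ suc r) _) ⟩
    + r * altStirlingBinomial n r + + suc r * altStirlingBinomial n (suc r)  ∎

altStirlingBinomial-pascal : ∀ n r →
  altStirling n (λ k → + (suc k C suc r)) ≡ altStirlingBinomial n r + altStirlingBinomial n (suc r)
altStirlingBinomial-pascal n r = begin
  altStirling n (λ k → + (suc k C suc r))
    ≡⟨ altStirling-cong n (λ k → cong +_ (nCk+nC[k+1]≡[n+1]C[k+1] k r)) ⟨
  altStirling n (λ k → + (k C r ℕ.+ k C suc r))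
    ≡⟨ altStirling-cong n (λ k → ℤ.pos-+ (k C r) (k C suc r)) ⟩
  altStirling n (λ k → + (k C r) + + (k C suc r))
    ≡⟨ altStirling-+ n _ _ ⟩
  altStirlingBinomial n r + altStirlingBinomial n (suc r)  ∎

Ppow-column-zero : ∀ n r → Ppow n r 0 ≡ sgn r * altStirlingBinomial n r
Ppow-column-zero zero    zero    = refl
Ppow-column-zero zero    (suc r) = sym (ℤ.*-zeroʳ (sgn (suc r)))
Ppow-column-zero (suc n) zero    = begin
  sumBelow 2 (λ k → P 0 k * Ppow n k 0)
    ≡⟨ sumBelow-cong 2 (λ k → cong (P 0 k *_) (Ppow-column-zero n k)) ⟩
  sumBelow 2 (λ k → P 0 k * (sgn k * A k))
    ≡⟨ P-row-zero (λ k → sgn k * A k) ⟩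
  - (1ℤ * A 0) - (- 1ℤ * A 1)
    ≡⟨ simplify (A 0) (A 1) ⟩
  1ℤ * (+ 0 * A 0 + + 1 * A 1 - A 0)
    ≡⟨ cong (1ℤ *_) (altStirlingBinomial-suc n 0) ⟨
  1ℤ * altStirlingBinomial (suc n) 0  ∎
  where
  A : ℕ → ℤ
  A = altStirlingBinomial n
  simplify : ∀ a b → - (1ℤ * a) - (- 1ℤ * b) ≡ 1ℤ * (0ℤ * a + 1ℤ * b - a)
  simplify = ℤ-Ring.solve-∀
Ppow-column-zero (suc n) (suc r) = begin
  sumBelow (3 ℕ.+ r) (λ k → P (suc r) k * Ppow n k 0)
    ≡⟨ sumBelow-cong (3 ℕ.+ r) (λ k → cong (P (suc r) k *_) (Ppow-column-zero n k)) ⟩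
  sumBelow (3 ℕ.+ r) (λ k → P (suc r) k * (sgn k * A k))
    ≡⟨ P-row-suc (λ k → sgn k * A k) r ⟩
  sgn r * A r + + r * (- sgn r * A (1 ℕ.+ r)) - + (2 ℕ.+ r) * (- - sgn r * A (2 ℕ.+ r))
    ≡⟨ simplify (sgn r) (+ r) (A r) (A (1 ℕ.+ r)) (A (2 ℕ.+ r)) ⟩
  - sgn r * (+ (1 ℕ.+ r) * A (1 ℕ.+ r) + + (2 ℕ.+ r) * A (2 ℕ.+ r) - (A r + A (1 ℕ.+ r)))
    ≡⟨ cong (λ x → - sgn r * (+ (1 ℕ.+ r) * A (1 ℕ.+ r) + + (2 ℕ.+ r) * A (2 ℕ.+ r) - x))
            (altStirlingBinomial-pascal n r) ⟨
  - sgn r * (+ (1 ℕ.+ r) * A (1 ℕ.+ r) + + (2 ℕ.+ r) * A (2 ℕ.+ r) - altStirling n (λ k → + (suc k C suc r)))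
    ≡⟨ cong (- sgn r *_) (altStirlingBinomial-suc n (suc r)) ⟨
  sgn (suc r) * altStirlingBinomial (suc n) (suc r)  ∎
  where
  A : ℕ → ℤ
  A = altStirlingBinomial n
  simplify : ∀ s x a b c → s * a + x * (- s * b) - (1ℤ + (1ℤ + x)) * (- - s * c)
                         ≡ - s * ((1ℤ + x) * b + (1ℤ + (1ℤ + x)) * c - (a + b))
  simplify = ℤ-Ring.solve-∀

proposition2p3 : (n : ℕ) → Bpm n ≡ Ppow n 0 0
proposition2p3 n = begin
  Bpm n                              ≡⟨ sumBelow-cong (suc n) (λ k → ℤ.*-identityʳ (sgn k * + S n k)) ⟨
  altStirlingBinomial n 0            ≡⟨ ℤ.*-identityˡ (altStirlingBinomial n 0) ⟨
  sgn 0 * altStirlingBinomial n 0    ≡⟨ Ppow-column-zero n 0 ⟨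
  Ppow n 0 0                         ∎
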